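{- Let $w=a\psi(v)b$ be a proper Christoffel word, $v\in\{a,b\}^*$. Then the depth of $w$ equals the height $h(v)$.
   Context: Palindromization map on $\{a,b\}^*$: $\psi(\varepsilon)=\varepsilon$, $\psi(ux)=(\psi(u)x)^{(+)}$, $z^{(+)}$ the shortest palindrome with prefix $z$. Christoffel words: the letters $a,b$ and the proper ones $a\psi(u)b$. Write nonempty $u$ uniquely as $x_0^{\alpha_0}\cdots x_m^{\alpha_m}$ with $\alpha_i\ge1$, $x_{i+1}\ne x_i$; the index of $a\psi(u)b$ is $\alpha_0$ ($0$ if $u=\varepsilon$). With $\varphi_k:a\mapsto a^{k+1}b,\ b\mapsto a^kb$ and $\hat\varphi_k:a\mapsto ab^k,\ b\mapsto ab^{k+1}$, the derivative of a proper Christoffel word $w=a\psi(u)b$ of index $k$ is $\partial ab=a$ if $k=0$, $\partial w=\varphi_k^{ -1}(w)$ if $k>0$ and $u$ begins with $a$, $\partial w=\hat\varphi_k^{ -1}(w)$ if $k>0$ and $u$ begins with $b$; it is again a Christoffel word, shorter than $w$. Higher derivatives: $\partial^{i+1}w=\partial(\partial^iw)$ as long as $\partial^iw$ is proper. The depth of $w$ is the least $d$ such that $\partial^dw$ is a single letter. A word is constant if it is a power of a single letter (including $\varepsilon$). For non-constant $u$, ${}_+u$ is the longest suffix of $u$ immediately preceded by the letter different from the first letter of $u$. Height: set $v_{(1)}=v$ and $v_{(n+1)}={}_+(v_{(n)})$ while $v_{(n)}$ is non-constant; $h(v)$ is the index $h$ such that $v_{(h)}$ is constant. -}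

module Defs where

open import Data.Nat using (ℕ; zero; suc; _<_)
open import Data.Bool using (Bool; true; false; _∧_; if_then_else_)
open import Data.List using (List; []; _∷_; _++_; [_]; reverse; take; drop; length; foldl; concatMap)
open import Data.List.Relation.Unary.All using (All)
open import Data.Product using (Σ; ∃; _×_; _,_)
open import Data.Sum using (_⊎_)
open import Data.Empty using (⊥)
open import Relation.Binary.PropositionalEquality using (_≡_)

data Letter : Set where
  a b : Letter

Word : Set
Word = List Letter

_==ᴸ_ : Letter → Letter → Bool
a ==ᴸ a = true
b ==ᴸ b = true
a ==ᴸ b = false
b ==ᴸ a = false

_==ᵂ_ : Word → Word → Bool
[] ==ᵂ [] = true
(x ∷ u) ==ᵂ (y ∷ v) = (x ==ᴸ y) ∧ (u ==ᵂ v)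
[] ==ᵂ (_ ∷ _) = false
(_ ∷ _) ==ᵂ [] = false

isPalindrome : Word → Bool
isPalindrome z = reverse z ==ᵂ z

-- Right palindromic closure z⁽⁺⁾: the shortest palindrome with prefix z.
-- It is z ++ reverse (take i z) for the least i such that drop i z is a
-- palindrome (search i = 0,1,...,|z|; i = |z| always succeeds).
closureFrom : ℕ → ℕ → Word → Word
closureFrom i zero z = z ++ reverse z
closureFrom i (suc fuel) z =
  if isPalindrome (drop i z) then z ++ reverse (take i z)
  else closureFrom (suc i) fuel z

closure : Word → Word
closure z = closureFrom 0 (length z) z

ψ : Word → Word
ψ = foldl (λ acc x → closure (acc ++ [ x ])) []

christoffel : Word → Word
christoffel u = a ∷ (ψ u ++ [ b ])

runLength : Letter → Word → ℕ
runLength x [] = zero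
runLength x (y ∷ u) = if x ==ᴸ y then suc (runLength x u) else zero

-- Index of a ψ(u) b: α₀ (0 if u = ε).
index : Word → ℕ
index [] = zero
index (x ∷ u) = suc (runLength x u)

rep : ℕ → Letter → Word
rep zero x = []
rep (suc n) x = x ∷ rep n x

φ : ℕ → Word → Word
φ k = concatMap f
  where
  f : Letter → Word
  f a = rep (suc k) a ++ [ b ]
  f b = rep k a ++ [ b ]

φ̂ : ℕ → Word → Word
φ̂ k = concatMap f
  where
  f : Letter → Word
  f a = a ∷ rep k b
  f b = a ∷ rep (suc k) b

-- Derivative, as a relation  Deriv w w'  meaning  ∂w = w'.
-- It is only defined for proper Christoffel words w = a ψ(u) b;
-- φ_k^{-1}(w) is the (unique, φ_k being injective) preimage.
data Deriv : Word → Word → Set where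
  deriv-ab : Deriv (christoffel []) [ a ]
  deriv-a  : ∀ u w' → φ (index (a ∷ u)) w' ≡ christoffel (a ∷ u) →
             Deriv (christoffel (a ∷ u)) w'
  deriv-b  : ∀ u w' → φ̂ (index (b ∷ u)) w' ≡ christoffel (b ∷ u) →
             Deriv (christoffel (b ∷ u)) w'

-- Iterated derivative:  Iter n w w'  means  ∂ⁿ w = w'  (each intermediate
-- word being proper, since Deriv is only defined on proper words).
data Iter : ℕ → Word → Word → Set where
  iter-zero : ∀ w → Iter zero w w
  iter-suc  : ∀ {n w w₁ w₂} → Deriv w w₁ → Iter n w₁ w₂ → Iter (suc n) w w₂

SingleLetter : Word → Set
SingleLetter w = Σ Letter (λ x → w ≡ [ x ])

Depth : Word → ℕ → Set
Depth w d =
  (Σ Word (λ w' → Iter d w w' × SingleLetter w')) ×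
  (∀ d' → d' < d → ∀ w' → Iter d' w w' → SingleLetter w' → ⊥)

Constant : Word → Set
Constant u = All (_≡ a) u ⊎ All (_≡ b) u

-- ₊u : the longest suffix of u immediately preceded by the letter
-- different from the first letter x of u, i.e. the suffix following the
-- first occurrence of that other letter.  (Junk value on constant u.)
afterFirstNot : Letter → Word → Word
afterFirstNot x [] = []
afterFirstNot x (y ∷ u) = if x ==ᴸ y then afterFirstNot x u else u

plus : Word → Word
plus [] = []
plus (x ∷ u) = afterFirstNot x u

iterate : ℕ → (Word → Word) → Word → Word
iterate zero f v = v
iterate (suc n) f v = f (iterate n f v)

-- Height: v₍₁₎ = v, v₍ₙ₊₁₎ = ₊(v₍ₙ₎) while v₍ₙ₎ is non-constant;
-- h(v) = h where v₍ₕ₎ is the first constant term.  v₍ₙ₊₁₎ = plusⁿ v.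
Height : Word → ℕ → Set
Height v h =
  Σ ℕ (λ n → (h ≡ suc n) × Constant (iterate n plus v) ×
     (∀ m → m < n → Constant (iterate m plus v) → ⊥))

-- Justin's formula ψ(xv) = μₓ(ψ v) x, where μₓ fixes x and sends the other letter y to xy, holds
-- because μₓ carries the longest palindromic suffix of a word onto that of its image, hence commutes
-- with palindromic closure. Iterating it, ψ(xᵏ y u) = μₓᵏ(μ_y(ψ u) y) xᵏ, and since φₖ (resp. φ̂ₖ) is
-- conjugate to μₐᵏ ∘ μ_b by aᵏ b (resp. to μ_bᵏ ∘ μₐ by bᵏ), the derivative of a ψ(xᵏ y u) b is a ψ(u) b,
-- where u = ₊(xᵏ y u), while the derivative of a ψ(xᵏ) b is the letter x. Injectivity of ψ, φₖ and φ̂ₖ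
-- makes the derivative unique, so the depth of a ψ(v) b and the height of v obey the same recursion
-- along v ↦ ₊v.

module Submission where

open import Defs
open import Data.Nat using (ℕ; zero; suc; _+_; _<_; _≤_; s≤s)
open import Data.Nat.Properties
  using (≤-reflexive; ≤-trans; n≤1+n; +-identityʳ; +-suc; m⊓n≤m; m<1+n⇒m<n∨m≡n; ≮⇒≥)
open import Data.Bool using (true; false)
open import Data.List using (List; []; _∷_; _++_; [_]; reverse; take; drop; length; foldl; concatMap)
open import Data.List.Properties
  using ( ∷-injective; ∷-injectiveˡ; ∷-injectiveʳ; ++-assoc; ++-identityʳ; ++-identityʳ-unique
        ; ++-conicalˡ; ++-cancelˡ; ∷ʳ-injectiveˡ; reverse-++; unfold-reverse; concatMap-++
        ; length-take; length-++-≤ʳ; take++drop≡id; take-all; drop-all)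
open import Data.List.Relation.Unary.All using (All; []; _∷_)
open import Data.List.Relation.Unary.All.Properties using (++⁻ʳ)
open import Data.Product using (Σ; _×_; _,_)
open import Data.Sum using (_⊎_; inj₁; inj₂)
open import Data.Empty using (⊥; ⊥-elim)
open import Function.Base using (_∘_)
open import Induction.WellFounded using (WellFounded; Acc; acc)
open import Data.Nat.Induction using (<-wellFounded)
open import Relation.Binary.Construct.On using () renaming (wellFounded to on-wellFounded)
open import Function.Bundles using (_⇔_; mk⇔; Equivalence)
open import Relation.Binary.PropositionalEquality
  using (_≡_; refl; sym; trans; cong; cong₂; subst; module ≡-Reasoning)
open ≡-Reasoning

-- Palindromic closure

Palindrome : Word → Set
Palindrome z = reverse z ≡ z

==ᵂ-sound : ∀ u v → (u ==ᵂ v) ≡ true → u ≡ v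
==ᵂ-sound [] [] _ = refl
==ᵂ-sound (a ∷ u) (a ∷ v) e = cong (a ∷_) (==ᵂ-sound u v e)
==ᵂ-sound (b ∷ u) (b ∷ v) e = cong (b ∷_) (==ᵂ-sound u v e)

==ᵂ-refl : ∀ u → (u ==ᵂ u) ≡ true
==ᵂ-refl [] = refl
==ᵂ-refl (a ∷ u) = ==ᵂ-refl u
==ᵂ-refl (b ∷ u) = ==ᵂ-refl u

isPalindrome-sound : ∀ z → isPalindrome z ≡ true → Palindrome z
isPalindrome-sound z = ==ᵂ-sound (reverse z) z

isPalindrome-complete : ∀ z → Palindrome z → isPalindrome z ≡ true
isPalindrome-complete z p = trans (cong (_==ᵂ z) p) (==ᵂ-refl z)

_≼_ : Word → Word → Set
U ≼ U′ = Σ Word λ V → U′ ≡ U ++ V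

≼-antisym : ∀ {U U′} → U ≼ U′ → U′ ≼ U → U ≡ U′
≼-antisym {U} (V , refl) (V′ , e) = begin
  U             ≡⟨ sym (++-identityʳ U) ⟩
  U ++ []       ≡⟨ cong (U ++_) (sym (++-conicalˡ V V′ (++-identityʳ-unique U U≡U++VV′))) ⟩
  U ++ V        ∎
  where
  U≡U++VV′ : U ≡ U ++ (V ++ V′)
  U≡U++VV′ = trans e (++-assoc U V V′)

≼-of-shorter : ∀ U U′ {S S′} → U ++ S ≡ U′ ++ S′ → length U ≤ length U′ → U ≼ U′
≼-of-shorter [] U′ _ _ = U′ , refl
≼-of-shorter (x ∷ U) (y ∷ U′) e (s≤s l) with refl , e′ ← ∷-injective e
  with V , refl ← ≼-of-shorter U U′ e′ l = V , refl

drop-length-++ : ∀ (U S : Word) → drop (length U) (U ++ S) ≡ S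
drop-length-++ [] S = refl
drop-length-++ (x ∷ U) S = drop-length-++ U S

record LongestPalSuffix (z U : Word) : Set where
  field
    suffix      : Word
    split       : z ≡ U ++ suffix
    palindromic : Palindrome suffix
    longest     : ∀ U′ S′ → z ≡ U′ ++ S′ → Palindrome S′ → U ≼ U′
open LongestPalSuffix

closureFrom-search : ∀ fuel i z → i + fuel ≡ length z →
  (∀ j → j < i → isPalindrome (drop j z) ≡ false) →
  Σ ℕ λ k → Palindrome (drop k z) × (∀ j → j < k → isPalindrome (drop j z) ≡ false) ×
            closureFrom i fuel z ≡ z ++ reverse (take k z)
closureFrom-search zero i z e below =
  i , subst Palindrome (sym (drop-all i z z≤i)) refl , below
    , cong (λ t → z ++ reverse t) (sym (take-all i z z≤i))
  where
  z≤i : length z ≤ i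
  z≤i = ≤-reflexive (trans (sym e) (+-identityʳ i))
closureFrom-search (suc fuel) i z e below with isPalindrome (drop i z) in isPal
... | true  = i , isPalindrome-sound _ isPal , below , refl
... | false = closureFrom-search fuel (suc i) z (trans (sym (+-suc i fuel)) e) below′
  where
  below′ : ∀ j → j < suc i → isPalindrome (drop j z) ≡ false
  below′ j j<1+i with m<1+n⇒m<n∨m≡n j<1+i
  ... | inj₁ j<i  = below j j<i
  ... | inj₂ refl = isPal

longestPalSuffix-closure : ∀ z → Σ Word λ U → LongestPalSuffix z U × closure z ≡ z ++ reverse U
longestPalSuffix-closure z with closureFrom-search (length z) 0 z refl (λ _ ())
... | k , pal , below , eq = take k z , lps , eq
  where
  k≤ : ∀ U′ S′ → z ≡ U′ ++ S′ → Palindrome S′ → k ≤ length U′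
  k≤ U′ S′ e p = ≮⇒≥ λ lt → false≢true (begin
    false                                      ≡⟨ below _ lt ⟨
    isPalindrome (drop (length U′) z)          ≡⟨ cong (λ t → isPalindrome (drop (length U′) t)) e ⟩
    isPalindrome (drop (length U′) (U′ ++ S′)) ≡⟨ cong isPalindrome (drop-length-++ U′ S′) ⟩
    isPalindrome S′                            ≡⟨ isPalindrome-complete S′ p ⟩
    true                                       ∎)
    where
    false≢true : false ≡ true → ⊥
    false≢true ()
  lps : LongestPalSuffix z (take k z)
  lps = record
    { suffix = drop k z
    ; split = sym (take++drop≡id k z)
    ; palindromic = pal
    ; longest = λ U′ S′ e p → ≼-of-shorter (take k z) U′ (trans (take++drop≡id k z) e)
        (≤-trans (≤-reflexive (length-take k z)) (≤-trans (m⊓n≤m k (length z)) (k≤ U′ S′ e p)))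
    }

closure-from-longestPalSuffix : ∀ {z U} → LongestPalSuffix z U → closure z ≡ z ++ reverse U
closure-from-longestPalSuffix {z} {U} lps with longestPalSuffix-closure z
... | U₀ , lps₀ , eq = trans eq (cong (λ t → z ++ reverse t) U₀≡U)
  where
  U₀≡U : U₀ ≡ U
  U₀≡U = ≼-antisym (longest lps₀ U (suffix lps) (split lps) (palindromic lps))
                   (longest lps U₀ (suffix lps₀) (split lps₀) (palindromic lps₀))

-- The morphisms μₓ and Justin's formula

other : Letter → Letter
other a = b
other b = a

other-≢ : ∀ x → other x ≡ x → ⊥
other-≢ a ()
other-≢ b ()

letter-dichotomy : ∀ x c → c ≡ x ⊎ c ≡ other x
letter-dichotomy a a = inj₁ refl
letter-dichotomy a b = inj₂ refl
letter-dichotomy b a = inj₂ refl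
letter-dichotomy b b = inj₁ refl

μ-letter : Letter → Letter → Word
μ-letter a a = [ a ]
μ-letter a b = a ∷ b ∷ []
μ-letter b a = b ∷ a ∷ []
μ-letter b b = [ b ]

μ : Letter → Word → Word
μ x = concatMap (μ-letter x)

-- ν x is μ x conjugated by x (μ-snoc); each of its blocks begins with the letter it encodes, so unlike
-- μ x it is decoded from the left.
ν-gap : Letter → Letter → Word
ν-gap a a = []
ν-gap a b = [ a ]
ν-gap b a = [ b ]
ν-gap b b = []

ν : Letter → Word → Word
ν x = concatMap (λ c → c ∷ ν-gap x c)

μ-++ : ∀ x A B → μ x (A ++ B) ≡ μ x A ++ μ x B
μ-++ x = concatMap-++ (μ-letter x)

μ-cons-same : ∀ x Z → μ x (x ∷ Z) ≡ x ∷ μ x Z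
μ-cons-same a Z = refl
μ-cons-same b Z = refl

μ-cons-other : ∀ x Z → μ x (other x ∷ Z) ≡ x ∷ other x ∷ μ x Z
μ-cons-other a Z = refl
μ-cons-other b Z = refl

μ-snoc : ∀ x Z → μ x Z ++ [ x ] ≡ x ∷ ν x Z
μ-snoc x [] = refl
μ-snoc x (c ∷ Z) = begin
  (μ-letter x c ++ μ x Z) ++ [ x ] ≡⟨ ++-assoc (μ-letter x c) (μ x Z) [ x ] ⟩
  μ-letter x c ++ (μ x Z ++ [ x ]) ≡⟨ cong (μ-letter x c ++_) (μ-snoc x Z) ⟩
  μ-letter x c ++ (x ∷ ν x Z)      ≡⟨ μ-letter-shift x c ⟩
  x ∷ c ∷ (ν-gap x c ++ ν x Z)     ∎
  where
  μ-letter-shift : ∀ x c {t} → μ-letter x c ++ (x ∷ t) ≡ x ∷ c ∷ (ν-gap x c ++ t)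
  μ-letter-shift a a = refl
  μ-letter-shift a b = refl
  μ-letter-shift b a = refl
  μ-letter-shift b b = refl

ν-injective : ∀ x {Z₁ Z₂} → ν x Z₁ ≡ ν x Z₂ → Z₁ ≡ Z₂
ν-injective x {[]} {[]} _ = refl
ν-injective x {c ∷ Z₁} {d ∷ Z₂} e with refl ← ∷-injectiveˡ e =
  cong (c ∷_) (ν-injective x (++-cancelˡ (ν-gap x c) _ _ (∷-injectiveʳ e)))

μ-snoc-injective : ∀ x {Z₁ Z₂} → μ x Z₁ ++ [ x ] ≡ μ x Z₂ ++ [ x ] → Z₁ ≡ Z₂
μ-snoc-injective x {Z₁} {Z₂} e =
  ν-injective x (∷-injectiveʳ (trans (sym (μ-snoc x Z₁)) (trans e (μ-snoc x Z₂))))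

reverse-ν : ∀ x Z → reverse (ν x Z) ≡ μ x (reverse Z)
reverse-ν x [] = refl
reverse-ν x (c ∷ Z) = begin
  reverse ((c ∷ ν-gap x c) ++ ν x Z)             ≡⟨ reverse-++ (c ∷ ν-gap x c) (ν x Z) ⟩
  reverse (ν x Z) ++ reverse (c ∷ ν-gap x c)     ≡⟨ cong₂ _++_ (reverse-ν x Z) (reverse-block x c) ⟩
  μ x (reverse Z) ++ μ x [ c ]                   ≡⟨ μ-++ x (reverse Z) [ c ] ⟨
  μ x (reverse Z ++ [ c ])                       ≡⟨ cong (μ x) (unfold-reverse c Z) ⟨
  μ x (reverse (c ∷ Z))                          ∎
  where
  reverse-block : ∀ x c → reverse (c ∷ ν-gap x c) ≡ μ x [ c ]
  reverse-block a a = refl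
  reverse-block a b = refl
  reverse-block b a = refl
  reverse-block b b = refl

reverse-μ-snoc : ∀ x Z → reverse (μ x Z ++ [ x ]) ≡ μ x (reverse Z) ++ [ x ]
reverse-μ-snoc x Z = begin
  reverse (μ x Z ++ [ x ])     ≡⟨ cong reverse (μ-snoc x Z) ⟩
  reverse (x ∷ ν x Z)          ≡⟨ unfold-reverse x (ν x Z) ⟩
  reverse (ν x Z) ++ [ x ]     ≡⟨ cong (_++ [ x ]) (reverse-ν x Z) ⟩
  μ x (reverse Z) ++ [ x ]     ∎

μ-snoc-palindrome : ∀ x {Z} → Palindrome Z → Palindrome (μ x Z ++ [ x ])
μ-snoc-palindrome x {Z} p = trans (reverse-μ-snoc x Z) (cong (λ t → μ x t ++ [ x ]) p)

μ-snoc-palindrome⁻ : ∀ x {Z} → Palindrome (μ x Z ++ [ x ]) → Palindrome Z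
μ-snoc-palindrome⁻ x {Z} p = μ-snoc-injective x (trans (sym (reverse-μ-snoc x Z)) p)

reverse-wrap : ∀ (c : Letter) W → reverse (c ∷ W ++ [ c ]) ≡ c ∷ reverse W ++ [ c ]
reverse-wrap c W = trans (unfold-reverse c (W ++ [ c ])) (cong (_++ [ c ]) (reverse-++ W [ c ]))

palindrome-wrap : ∀ c {W} → Palindrome W → Palindrome (c ∷ W ++ [ c ])
palindrome-wrap c {W} p = trans (reverse-wrap c W) (cong (λ t → c ∷ t ++ [ c ]) p)

palindrome-unwrap : ∀ c {W} → Palindrome (c ∷ W ++ [ c ]) → Palindrome W
palindrome-unwrap c {W} p = ∷ʳ-injectiveˡ (reverse W) W (∷-injectiveʳ (trans (sym (reverse-wrap c W)) p))

palindromic-suffix-head : ∀ A c U′ d S → A ++ [ c ] ≡ U′ ++ d ∷ S → Palindrome (d ∷ S) → d ≡ c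
palindromic-suffix-head A c U′ d S e p = sym (∷-injectiveˡ (begin
  c ∷ reverse A               ≡⟨ reverse-++ A [ c ] ⟨
  reverse (A ++ [ c ])        ≡⟨ cong reverse e ⟩
  reverse (U′ ++ d ∷ S)       ≡⟨ reverse-++ U′ (d ∷ S) ⟩
  reverse (d ∷ S) ++ reverse U′ ≡⟨ cong (_++ reverse U′) p ⟩
  (d ∷ S) ++ reverse U′       ∎))

++-∷-≢-[] : ∀ {A : Set} (xs : List A) {y ys} → xs ++ y ∷ ys ≡ [] → ⊥
++-∷-≢-[] [] ()
++-∷-≢-[] (_ ∷ _) ()

suffix-of-snoc : ∀ {A : Set} (xs : List A) c ys d zs → xs ++ [ c ] ≡ ys ++ d ∷ zs →
  zs ≡ [] ⊎ Σ (List A) λ zs′ → zs ≡ zs′ ++ [ c ]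
suffix-of-snoc []       c []       d zs e = inj₁ (sym (∷-injectiveʳ e))
suffix-of-snoc []       c (_ ∷ ys) d zs e = ⊥-elim (++-∷-≢-[] ys (sym (∷-injectiveʳ e)))
suffix-of-snoc (_ ∷ xs) c []       d zs e = inj₂ (xs , sym (∷-injectiveʳ e))
suffix-of-snoc (_ ∷ xs) c (_ ∷ ys) d zs e = suffix-of-snoc xs c ys d zs (∷-injectiveʳ e)

μ-snoc-cut : ∀ x Z U′ T → μ x Z ++ [ x ] ≡ U′ ++ x ∷ T →
  Σ Word λ Z₁ → Σ Word λ Z₂ → Z ≡ Z₁ ++ Z₂ × U′ ≡ μ x Z₁ × x ∷ T ≡ μ x Z₂ ++ [ x ]
μ-snoc-cut x Z [] T e = [] , Z , refl , refl , sym e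
μ-snoc-cut x [] (_ ∷ U₁) T e = ⊥-elim (++-∷-≢-[] U₁ (sym (∷-injectiveʳ e)))
μ-snoc-cut x (c ∷ Z) (d ∷ U₁) T e with letter-dichotomy x c
... | inj₁ refl
  with refl , e′ ← ∷-injective (trans (cong (_++ [ x ]) (sym (μ-cons-same x Z))) e)
  with Z₁ , Z₂ , refl , refl , p ← μ-snoc-cut x Z U₁ T e′
  = x ∷ Z₁ , Z₂ , refl , sym (μ-cons-same x Z₁) , p
... | inj₂ refl with ∷-injective (trans (cong (_++ [ x ]) (sym (μ-cons-other x Z))) e)
μ-snoc-cut x (_ ∷ Z) (_ ∷ []) T e | inj₂ refl | refl , e′ = ⊥-elim (other-≢ x (∷-injectiveˡ e′))
μ-snoc-cut x (_ ∷ Z) (_ ∷ _ ∷ U₂) T e | inj₂ refl | refl , e′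
  with refl , e″ ← ∷-injective e′
  with Z₁ , Z₂ , refl , refl , p ← μ-snoc-cut x Z U₂ T e″
  = other x ∷ Z₁ , Z₂ , refl , sym (μ-cons-other x Z₁) , p

-- An occurrence of the other letter in μ x Z is always the second letter of a block x (other x).
μ-cut-other : ∀ x Z U′ R → μ x Z ≡ U′ ++ other x ∷ R →
  Σ Word λ Z₁ → Σ Word λ Z₂ → Z ≡ Z₁ ++ other x ∷ Z₂ × U′ ≡ μ x Z₁ ++ [ x ] × R ≡ μ x Z₂
μ-cut-other x [] U′ R e = ⊥-elim (++-∷-≢-[] U′ (sym e))
μ-cut-other x (c ∷ Z) U′ R e with letter-dichotomy x c
μ-cut-other x (_ ∷ Z) [] R e | inj₁ refl = ⊥-elim (other-≢ x (sym (∷-injectiveˡ (trans (sym (μ-cons-same x Z)) e))))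
μ-cut-other x (_ ∷ Z) (_ ∷ U₁) R e | inj₁ refl
  with refl , e′ ← ∷-injective (trans (sym (μ-cons-same x Z)) e)
  with Z₁ , Z₂ , refl , refl , p ← μ-cut-other x Z U₁ R e′
  = x ∷ Z₁ , Z₂ , refl , cong (_++ [ x ]) (sym (μ-cons-same x Z₁)) , p
... | inj₂ refl with U′ | trans (sym (μ-cons-other x Z)) e
... | [] | e′ = ⊥-elim (other-≢ x (sym (∷-injectiveˡ e′)))
... | _ ∷ [] | e′ with refl , e″ ← ∷-injective e′ = [] , Z , refl , refl , sym (∷-injectiveʳ e″)
... | _ ∷ _ ∷ U₂ | e′
  with refl , e″ ← ∷-injective e′
  with refl , e‴ ← ∷-injective e″
  with Z₁ , Z₂ , refl , refl , p ← μ-cut-other x Z U₂ R e‴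
  = other x ∷ Z₁ , Z₂ , refl , cong (_++ [ x ]) (sym (μ-cons-other x Z₁)) , p

μ-≼ : ∀ x {U U′} → U ≼ U′ → μ x U ≼ μ x U′
μ-≼ x {U} (V , refl) = μ x V , μ-++ x U V

μ-snoc-≼ : ∀ x {U U′} → U ≼ U′ → (μ x U ++ [ x ]) ≼ (μ x U′ ++ [ x ])
μ-snoc-≼ x {U} (V , refl) = ν x V , (begin
  μ x (U ++ V) ++ [ x ]        ≡⟨ cong (_++ [ x ]) (μ-++ x U V) ⟩
  (μ x U ++ μ x V) ++ [ x ]    ≡⟨ ++-assoc (μ x U) (μ x V) [ x ] ⟩
  μ x U ++ (μ x V ++ [ x ])    ≡⟨ cong (μ x U ++_) (μ-snoc x V) ⟩
  μ x U ++ x ∷ ν x V           ≡⟨ ++-assoc (μ x U) [ x ] (ν x V) ⟨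
  (μ x U ++ [ x ]) ++ ν x V    ∎)

μ-++-reverse-μ-snoc : ∀ x Z U → μ x Z ++ reverse (μ x U ++ [ x ]) ≡ μ x (Z ++ reverse U) ++ [ x ]
μ-++-reverse-μ-snoc x Z U = begin
  μ x Z ++ reverse (μ x U ++ [ x ])     ≡⟨ cong (μ x Z ++_) (reverse-μ-snoc x U) ⟩
  μ x Z ++ (μ x (reverse U) ++ [ x ])   ≡⟨ ++-assoc (μ x Z) (μ x (reverse U)) [ x ] ⟨
  (μ x Z ++ μ x (reverse U)) ++ [ x ]   ≡⟨ cong (_++ [ x ]) (μ-++ x Z (reverse U)) ⟨
  μ x (Z ++ reverse U) ++ [ x ]         ∎

μ-snoc-longestPalSuffix : ∀ x {Z U} → LongestPalSuffix Z U → LongestPalSuffix (μ x Z ++ [ x ]) (μ x U)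
μ-snoc-longestPalSuffix x {Z} {U} lps = record
  { suffix = μ x S ++ [ x ]
  ; split = split′
  ; palindromic = μ-snoc-palindrome x (palindromic lps)
  ; longest = longest′
  }
  where
  S = suffix lps
  split′ : μ x Z ++ [ x ] ≡ μ x U ++ (μ x S ++ [ x ])
  split′ = begin
    μ x Z ++ [ x ]              ≡⟨ cong (λ t → μ x t ++ [ x ]) (split lps) ⟩
    μ x (U ++ S) ++ [ x ]       ≡⟨ cong (_++ [ x ]) (μ-++ x U S) ⟩
    (μ x U ++ μ x S) ++ [ x ]   ≡⟨ ++-assoc (μ x U) (μ x S) [ x ] ⟩
    μ x U ++ (μ x S ++ [ x ])   ∎
  longest′ : ∀ U′ S′ → μ x Z ++ [ x ] ≡ U′ ++ S′ → Palindrome S′ → μ x U ≼ U′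
  longest′ U′ [] e _ = μ x S ++ [ x ] , trans (sym (trans e (++-identityʳ U′))) split′
  longest′ U′ (d ∷ S″) e p with refl ← palindromic-suffix-head (μ x Z) x U′ d S″ e p
    with Z₁ , Z₂ , Z≡ , refl , S′≡ ← μ-snoc-cut x Z U′ S″ e =
    μ-≼ x (longest lps Z₁ Z₂ Z≡ (μ-snoc-palindrome⁻ x (subst Palindrome S′≡ p)))

closure-μ-snoc : ∀ x Z → closure (μ x Z ++ [ x ]) ≡ μ x (closure Z) ++ [ x ]
closure-μ-snoc x Z with longestPalSuffix-closure Z
... | U , lps , closure≡ = begin
  closure (μ x Z ++ [ x ])              ≡⟨ closure-from-longestPalSuffix (μ-snoc-longestPalSuffix x lps) ⟩
  (μ x Z ++ [ x ]) ++ reverse (μ x U)   ≡⟨ ++-assoc (μ x Z) [ x ] (reverse (μ x U)) ⟩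
  μ x Z ++ x ∷ reverse (μ x U)          ≡⟨ cong (μ x Z ++_) (reverse-++ (μ x U) [ x ]) ⟨
  μ x Z ++ reverse (μ x U ++ [ x ])     ≡⟨ μ-++-reverse-μ-snoc x Z U ⟩
  μ x (Z ++ reverse U) ++ [ x ]         ≡⟨ cong (λ t → μ x t ++ [ x ]) closure≡ ⟨
  μ x (closure Z) ++ [ x ]              ∎

μ-snoc-same : ∀ x Z → μ x (Z ++ [ x ]) ≡ μ x Z ++ [ x ]
μ-snoc-same x Z = trans (μ-++ x Z [ x ]) (cong (μ x Z ++_) (μ-cons-same x []))

μ-snoc-other : ∀ x Z → μ x (Z ++ [ other x ]) ≡ (μ x Z ++ [ x ]) ++ [ other x ]
μ-snoc-other x Z = begin
  μ x (Z ++ [ other x ])             ≡⟨ μ-++ x Z [ other x ] ⟩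
  μ x Z ++ μ x [ other x ]           ≡⟨ cong (μ x Z ++_) (μ-cons-other x []) ⟩
  μ x Z ++ x ∷ other x ∷ []          ≡⟨ ++-assoc (μ x Z) [ x ] [ other x ] ⟨
  (μ x Z ++ [ x ]) ++ [ other x ]    ∎

palindrome-other-μ : ∀ x T → T ≡ [] ⊎ Σ Word (λ W → T ≡ W ++ [ other x ]) →
  Palindrome (other x ∷ T) ⇔ Palindrome (other x ∷ μ x T)
palindrome-other-μ x _ (inj₁ refl) = mk⇔ (λ _ → refl) (λ _ → refl)
palindrome-other-μ x _ (inj₂ (W , refl)) = mk⇔
  (λ p → subst Palindrome (sym image) (palindrome-wrap y (μ-snoc-palindrome x (palindrome-unwrap y p))))
  (λ p → palindrome-wrap y (μ-snoc-palindrome⁻ x (palindrome-unwrap y (subst Palindrome image p))))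
  where
  y = other x
  image : y ∷ μ x (W ++ [ y ]) ≡ y ∷ (μ x W ++ [ x ]) ++ [ y ]
  image = cong (y ∷_) (μ-snoc-other x W)

-- [ c ] is itself a palindromic suffix of Z ++ [ c ], so the longest one begins and ends with c.
longestPalSuffix-snoc : ∀ c {Z U} (lps : LongestPalSuffix (Z ++ [ c ]) U) →
  Σ Word λ T → suffix lps ≡ c ∷ T × (T ≡ [] ⊎ Σ Word λ W → T ≡ W ++ [ c ])
longestPalSuffix-snoc c {Z} {U} lps with longest lps Z [ c ] refl refl
... | V₀ , refl = ending-in V₀ (++-cancelˡ U _ _ (trans (sym (split lps)) (++-assoc U V₀ [ c ])))
  where
  ending-in : ∀ V → suffix lps ≡ V ++ [ c ] →
    Σ Word λ T → suffix lps ≡ c ∷ T × (T ≡ [] ⊎ Σ Word λ W → T ≡ W ++ [ c ])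
  ending-in [] e = [] , e , inj₁ refl
  ending-in (d ∷ W) e
    with refl ← palindromic-suffix-head (d ∷ W) c [] d (W ++ [ c ]) refl (subst Palindrome e (palindromic lps))
    = W ++ [ c ] , e , inj₂ (W , refl)

μ-other-longestPalSuffix : ∀ x {Z U} → LongestPalSuffix (Z ++ [ other x ]) U →
  LongestPalSuffix (μ x (Z ++ [ other x ])) (μ x U ++ [ x ])
μ-other-longestPalSuffix x {Z} {U} lps with longestPalSuffix-snoc (other x) lps
... | T , S≡yT , shape = record
  { suffix = y ∷ μ x T
  ; split = split′
  ; palindromic = Equivalence.to (palindrome-other-μ x T shape) (subst Palindrome S≡yT (palindromic lps))
  ; longest = longest′
  }
  where
  y = other x
  split′ : μ x (Z ++ [ y ]) ≡ (μ x U ++ [ x ]) ++ y ∷ μ x T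
  split′ = begin
    μ x (Z ++ [ y ])             ≡⟨ cong (μ x) (trans (split lps) (cong (U ++_) S≡yT)) ⟩
    μ x (U ++ y ∷ T)             ≡⟨ μ-++ x U (y ∷ T) ⟩
    μ x U ++ μ x (y ∷ T)         ≡⟨ cong (μ x U ++_) (μ-cons-other x T) ⟩
    μ x U ++ x ∷ y ∷ μ x T       ≡⟨ ++-assoc (μ x U) [ x ] (y ∷ μ x T) ⟨
    (μ x U ++ [ x ]) ++ y ∷ μ x T ∎
  longest′ : ∀ U′ S′ → μ x (Z ++ [ y ]) ≡ U′ ++ S′ → Palindrome S′ → (μ x U ++ [ x ]) ≼ U′
  longest′ U′ [] e _ = y ∷ μ x T , trans (sym (trans e (++-identityʳ U′))) split′
  longest′ U′ (d ∷ S″) e p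
    with refl ← palindromic-suffix-head (μ x Z ++ [ x ]) y U′ d S″ (trans (sym (μ-snoc-other x Z)) e) p
    with Z₁ , Z₂ , Zy≡ , refl , refl ← μ-cut-other x (Z ++ [ y ]) U′ S″ e =
    μ-snoc-≼ x (longest lps Z₁ (y ∷ Z₂) Zy≡ pal)
    where
    pal : Palindrome (y ∷ Z₂)
    pal = Equivalence.from (palindrome-other-μ x Z₂ (suffix-of-snoc Z y Z₁ y Z₂ Zy≡)) p

closure-μ-other : ∀ x Z → closure (μ x (Z ++ [ other x ])) ≡ μ x (closure (Z ++ [ other x ])) ++ [ x ]
closure-μ-other x Z with longestPalSuffix-closure (Z ++ [ other x ])
... | U , lps , closure≡ = begin
  closure (μ x Zy)                        ≡⟨ closure-from-longestPalSuffix (μ-other-longestPalSuffix x lps) ⟩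
  μ x Zy ++ reverse (μ x U ++ [ x ])      ≡⟨ μ-++-reverse-μ-snoc x Zy U ⟩
  μ x (Zy ++ reverse U) ++ [ x ]          ≡⟨ cong (λ t → μ x t ++ [ x ]) closure≡ ⟨
  μ x (closure Zy) ++ [ x ]               ∎
  where
  Zy = Z ++ [ other x ]

ψ-step : Word → Letter → Word
ψ-step w y = closure (w ++ [ y ])

ψ-step-μ-snoc : ∀ x P y → ψ-step (μ x P ++ [ x ]) y ≡ μ x (ψ-step P y) ++ [ x ]
ψ-step-μ-snoc x P y with letter-dichotomy x y
... | inj₁ refl = begin
  closure ((μ x P ++ [ x ]) ++ [ x ])   ≡⟨ cong (λ t → closure (t ++ [ x ])) (μ-snoc-same x P) ⟨
  closure (μ x (P ++ [ x ]) ++ [ x ])   ≡⟨ closure-μ-snoc x (P ++ [ x ]) ⟩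
  μ x (closure (P ++ [ x ])) ++ [ x ]   ∎
... | inj₂ refl = begin
  closure ((μ x P ++ [ x ]) ++ [ y ])   ≡⟨ cong closure (μ-snoc-other x P) ⟨
  closure (μ x (P ++ [ y ]))            ≡⟨ closure-μ-other x P ⟩
  μ x (closure (P ++ [ y ])) ++ [ x ]   ∎

foldl-ψ-step-μ-snoc : ∀ x v P → foldl ψ-step (μ x P ++ [ x ]) v ≡ μ x (foldl ψ-step P v) ++ [ x ]
foldl-ψ-step-μ-snoc x [] P = refl
foldl-ψ-step-μ-snoc x (y ∷ v) P =
  trans (cong (λ t → foldl ψ-step t v) (ψ-step-μ-snoc x P y)) (foldl-ψ-step-μ-snoc x v (ψ-step P y))

ψ-cons : ∀ x v → ψ (x ∷ v) ≡ μ x (ψ v) ++ [ x ]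
ψ-cons a v = foldl-ψ-step-μ-snoc a v []
ψ-cons b v = foldl-ψ-step-μ-snoc b v []

-- Derivatives of Christoffel words

rep-snoc : ∀ n (x : Letter) → rep n x ++ [ x ] ≡ x ∷ rep n x
rep-snoc zero x = refl
rep-snoc (suc n) x = cong (x ∷_) (rep-snoc n x)

record IsMorphism (f : Word → Word) : Set where
  field
    preserves-[] : f [] ≡ []
    preserves-++ : ∀ A B → f (A ++ B) ≡ f A ++ f B
open IsMorphism

concatMap-isMorphism : ∀ g → IsMorphism (concatMap g)
concatMap-isMorphism g = record { preserves-[] = refl ; preserves-++ = concatMap-++ g }

∘-isMorphism : ∀ {f g} → IsMorphism f → IsMorphism g → IsMorphism (f ∘ g)
∘-isMorphism {f} {g} F G = record
  { preserves-[] = trans (cong f (preserves-[] G)) (preserves-[] F)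
  ; preserves-++ = λ A B → trans (cong f (preserves-++ G A B)) (preserves-++ F (g A) (g B))
  }

iterate-isMorphism : ∀ {f} → IsMorphism f → ∀ n → IsMorphism (iterate n f)
iterate-isMorphism F zero = record { preserves-[] = refl ; preserves-++ = λ _ _ → refl }
iterate-isMorphism F (suc n) = ∘-isMorphism F (iterate-isMorphism F n)

iterate-fixed : ∀ {f : Word → Word} {w} → f w ≡ w → ∀ n → iterate n f w ≡ w
iterate-fixed fw≡w zero = refl
iterate-fixed {f} fw≡w (suc n) = trans (cong f (iterate-fixed fw≡w n)) fw≡w

morphism-conjugate : ∀ {f g} → IsMorphism f → IsMorphism g → ∀ C →
  (∀ c → f [ c ] ++ C ≡ C ++ g [ c ]) → ∀ P → f P ++ C ≡ C ++ g P
morphism-conjugate {f} {g} F G C onLetters [] = begin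
  f [] ++ C    ≡⟨ cong (_++ C) (preserves-[] F) ⟩
  C            ≡⟨ ++-identityʳ C ⟨
  C ++ []      ≡⟨ cong (C ++_) (preserves-[] G) ⟨
  C ++ g []    ∎
morphism-conjugate {f} {g} F G C onLetters (c ∷ P) = begin
  f ([ c ] ++ P) ++ C         ≡⟨ cong (_++ C) (preserves-++ F [ c ] P) ⟩
  (f [ c ] ++ f P) ++ C       ≡⟨ ++-assoc (f [ c ]) (f P) C ⟩
  f [ c ] ++ (f P ++ C)       ≡⟨ cong (f [ c ] ++_) (morphism-conjugate F G C onLetters P) ⟩
  f [ c ] ++ (C ++ g P)       ≡⟨ ++-assoc (f [ c ]) C (g P) ⟨
  (f [ c ] ++ C) ++ g P       ≡⟨ cong (_++ g P) (onLetters c) ⟩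
  (C ++ g [ c ]) ++ g P       ≡⟨ ++-assoc C (g [ c ]) (g P) ⟩
  C ++ (g [ c ] ++ g P)       ≡⟨ cong (C ++_) (preserves-++ G [ c ] P) ⟨
  C ++ g ([ c ] ++ P)         ∎

μ-isMorphism : ∀ x → IsMorphism (μ x)
μ-isMorphism x = concatMap-isMorphism (μ-letter x)

μ-rep : ∀ x n → μ x (rep n x) ≡ rep n x
μ-rep x zero = refl
μ-rep x (suc n) = trans (μ-cons-same x (rep n x)) (cong (x ∷_) (μ-rep x n))

iterate-μ-same : ∀ x n → iterate n (μ x) [ x ] ≡ [ x ]
iterate-μ-same x = iterate-fixed (μ-cons-same x [])

iterate-μ-other : ∀ x n → iterate n (μ x) [ other x ] ≡ rep n x ++ [ other x ]
iterate-μ-other x zero = refl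
iterate-μ-other x (suc n) = begin
  μ x (iterate n (μ x) [ other x ])   ≡⟨ cong (μ x) (iterate-μ-other x n) ⟩
  μ x (rep n x ++ [ other x ])        ≡⟨ μ-++ x (rep n x) [ other x ] ⟩
  μ x (rep n x) ++ μ x [ other x ]    ≡⟨ cong₂ _++_ (μ-rep x n) (μ-cons-other x []) ⟩
  rep n x ++ x ∷ other x ∷ []         ≡⟨ ++-assoc (rep n x) [ x ] [ other x ] ⟨
  (rep n x ++ [ x ]) ++ [ other x ]   ≡⟨ cong (_++ [ other x ]) (rep-snoc n x) ⟩
  x ∷ rep n x ++ [ other x ]          ∎

ψ-rep-++ : ∀ n x w → ψ (rep n x ++ w) ≡ iterate n (μ x) (ψ w) ++ rep n x
ψ-rep-++ zero x w = sym (++-identityʳ (ψ w))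
ψ-rep-++ (suc n) x w = begin
  ψ (x ∷ rep n x ++ w)              ≡⟨ ψ-cons x (rep n x ++ w) ⟩
  μ x (ψ (rep n x ++ w)) ++ [ x ]   ≡⟨ cong (λ t → μ x t ++ [ x ]) (ψ-rep-++ n x w) ⟩
  μ x (I ++ rep n x) ++ [ x ]       ≡⟨ cong (_++ [ x ]) (μ-++ x I (rep n x)) ⟩
  (μ x I ++ μ x (rep n x)) ++ [ x ] ≡⟨ cong (λ t → (μ x I ++ t) ++ [ x ]) (μ-rep x n) ⟩
  (μ x I ++ rep n x) ++ [ x ]       ≡⟨ ++-assoc (μ x I) (rep n x) [ x ] ⟩
  μ x I ++ (rep n x ++ [ x ])       ≡⟨ cong (μ x I ++_) (rep-snoc n x) ⟩
  μ x I ++ x ∷ rep n x              ∎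
  where
  I = iterate n (μ x) (ψ w)

ψ-rep : ∀ n x → ψ (rep n x) ≡ rep n x
ψ-rep n x = begin
  ψ (rep n x)                      ≡⟨ cong ψ (++-identityʳ (rep n x)) ⟨
  ψ (rep n x ++ [])                ≡⟨ ψ-rep-++ n x [] ⟩
  iterate n (μ x) [] ++ rep n x    ≡⟨ cong (_++ rep n x) (iterate-fixed refl n) ⟩
  rep n x                          ∎

φ-conjugate : ∀ k P → iterate k (μ a) (μ b P) ++ (rep k a ++ [ b ]) ≡ (rep k a ++ [ b ]) ++ φ k P
φ-conjugate k = morphism-conjugate (∘-isMorphism I (μ-isMorphism b)) (concatMap-isMorphism _) C onLetters
  where
  I = iterate-isMorphism (μ-isMorphism a) k
  C = rep k a ++ [ b ]
  onLetters : ∀ c → iterate k (μ a) (μ b [ c ]) ++ C ≡ C ++ φ k [ c ]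
  onLetters a = begin
    iterate k (μ a) ([ b ] ++ [ a ]) ++ C   ≡⟨ cong (_++ C) (preserves-++ I [ b ] [ a ]) ⟩
    (iterate k (μ a) [ b ] ++ iterate k (μ a) [ a ]) ++ C
                                            ≡⟨ cong (_++ C) (cong₂ _++_ (iterate-μ-other a k) (iterate-μ-same a k)) ⟩
    (C ++ [ a ]) ++ C                       ≡⟨ ++-assoc C [ a ] C ⟩
    C ++ a ∷ C                              ≡⟨ cong (C ++_) (++-identityʳ (a ∷ C)) ⟨
    C ++ φ k [ a ]                          ∎
  onLetters b = cong₂ _++_ (iterate-μ-other a k) (sym (++-identityʳ C))

φ̂-conjugate : ∀ k P → iterate k (μ b) (μ a P) ++ rep k b ≡ rep k b ++ φ̂ k P
φ̂-conjugate k = morphism-conjugate (∘-isMorphism I (μ-isMorphism a)) (concatMap-isMorphism _) B onLetters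
  where
  I = iterate-isMorphism (μ-isMorphism b) k
  B = rep k b
  onLetters : ∀ c → iterate k (μ b) (μ a [ c ]) ++ B ≡ B ++ φ̂ k [ c ]
  onLetters a = begin
    iterate k (μ b) [ a ] ++ B              ≡⟨ cong (_++ B) (iterate-μ-other b k) ⟩
    (B ++ [ a ]) ++ B                       ≡⟨ ++-assoc B [ a ] B ⟩
    B ++ a ∷ B                              ≡⟨ cong (B ++_) (++-identityʳ (a ∷ B)) ⟨
    B ++ φ̂ k [ a ]                          ∎
  onLetters b = begin
    iterate k (μ b) ([ a ] ++ [ b ]) ++ B   ≡⟨ cong (_++ B) (preserves-++ I [ a ] [ b ]) ⟩
    (iterate k (μ b) [ a ] ++ iterate k (μ b) [ b ]) ++ B
                                            ≡⟨ cong (_++ B) (cong₂ _++_ (iterate-μ-other b k) (iterate-μ-same b k)) ⟩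
    ((B ++ [ a ]) ++ [ b ]) ++ B            ≡⟨ ++-assoc (B ++ [ a ]) [ b ] B ⟩
    (B ++ [ a ]) ++ b ∷ B                   ≡⟨ ++-assoc B [ a ] (b ∷ B) ⟩
    B ++ a ∷ b ∷ B                          ≡⟨ cong (B ++_) (++-identityʳ (a ∷ b ∷ B)) ⟨
    B ++ φ̂ k [ b ]                          ∎

φ-christoffel : ∀ k u → φ k (christoffel u) ≡ christoffel (rep k a ++ b ∷ u)
φ-christoffel k u = begin
  (a ∷ C) ++ φ k (P ++ [ b ])             ≡⟨ cong (λ t → a ∷ C ++ t) (concatMap-++ _ P [ b ]) ⟩
  a ∷ C ++ (φ k P ++ (C ++ []))           ≡⟨ cong (λ t → a ∷ C ++ (φ k P ++ t)) (++-identityʳ C) ⟩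
  a ∷ C ++ (φ k P ++ C)                   ≡⟨ cong (a ∷_) (++-assoc C (φ k P) C) ⟨
  a ∷ (C ++ φ k P) ++ C                   ≡⟨ cong (λ t → a ∷ t ++ C) (φ-conjugate k P) ⟨
  a ∷ (X ++ C) ++ C                       ≡⟨ cong (a ∷_) (++-assoc (X ++ C) (rep k a) [ b ]) ⟨
  a ∷ ((X ++ C) ++ rep k a) ++ [ b ]      ≡⟨ cong (λ t → a ∷ (t ++ rep k a) ++ [ b ]) ψ-image ⟨
  a ∷ (I (ψ (b ∷ u)) ++ rep k a) ++ [ b ] ≡⟨ cong (λ t → a ∷ t ++ [ b ]) (ψ-rep-++ k a (b ∷ u)) ⟨
  christoffel (rep k a ++ b ∷ u)          ∎
  where
  P = ψ u
  C = rep k a ++ [ b ]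
  I = iterate k (μ a)
  X = I (μ b P)
  ψ-image : I (ψ (b ∷ u)) ≡ X ++ C
  ψ-image = begin
    I (ψ (b ∷ u))        ≡⟨ cong I (ψ-cons b u) ⟩
    I (μ b P ++ [ b ])   ≡⟨ preserves-++ (iterate-isMorphism (μ-isMorphism a) k) (μ b P) [ b ] ⟩
    X ++ I [ b ]         ≡⟨ cong (X ++_) (iterate-μ-other a k) ⟩
    X ++ C               ∎

φ̂-christoffel : ∀ k u → φ̂ k (christoffel u) ≡ christoffel (rep k b ++ a ∷ u)
φ̂-christoffel k u = begin
  a ∷ B ++ φ̂ k (P ++ [ b ])               ≡⟨ cong (λ t → a ∷ B ++ t) (concatMap-++ _ P [ b ]) ⟩
  a ∷ B ++ (φ̂ k P ++ ((a ∷ b ∷ B) ++ [])) ≡⟨ cong (λ t → a ∷ B ++ (φ̂ k P ++ t)) (++-identityʳ (a ∷ b ∷ B)) ⟩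
  a ∷ B ++ (φ̂ k P ++ a ∷ b ∷ B)           ≡⟨ cong (a ∷_) (++-assoc B (φ̂ k P) (a ∷ b ∷ B)) ⟨
  a ∷ (B ++ φ̂ k P) ++ a ∷ b ∷ B           ≡⟨ cong (λ t → a ∷ t ++ a ∷ b ∷ B) (φ̂-conjugate k P) ⟨
  a ∷ (X ++ B) ++ a ∷ b ∷ B               ≡⟨ cong (a ∷_) rearrange ⟩
  a ∷ ((X ++ B ++ [ a ]) ++ B) ++ [ b ]   ≡⟨ cong (λ t → a ∷ (t ++ B) ++ [ b ]) ψ-image ⟨
  a ∷ (I (ψ (a ∷ u)) ++ B) ++ [ b ]       ≡⟨ cong (λ t → a ∷ t ++ [ b ]) (ψ-rep-++ k b (a ∷ u)) ⟨
  christoffel (rep k b ++ a ∷ u)          ∎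
  where
  P = ψ u
  B = rep k b
  I = iterate k (μ b)
  X = I (μ a P)
  ψ-image : I (ψ (a ∷ u)) ≡ X ++ B ++ [ a ]
  ψ-image = begin
    I (ψ (a ∷ u))        ≡⟨ cong I (ψ-cons a u) ⟩
    I (μ a P ++ [ a ])   ≡⟨ preserves-++ (iterate-isMorphism (μ-isMorphism b) k) (μ a P) [ a ] ⟩
    X ++ I [ a ]         ≡⟨ cong (X ++_) (iterate-μ-other b k) ⟩
    X ++ B ++ [ a ]      ∎
  rearrange : (X ++ B) ++ a ∷ b ∷ B ≡ ((X ++ B ++ [ a ]) ++ B) ++ [ b ]
  rearrange = begin
    (X ++ B) ++ a ∷ b ∷ B            ≡⟨ cong (λ t → (X ++ B) ++ a ∷ t) (rep-snoc k b) ⟨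
    (X ++ B) ++ a ∷ B ++ [ b ]       ≡⟨ ++-assoc X B (a ∷ B ++ [ b ]) ⟩
    X ++ B ++ a ∷ B ++ [ b ]         ≡⟨ cong (X ++_) (++-assoc B [ a ] (B ++ [ b ])) ⟨
    X ++ (B ++ [ a ]) ++ B ++ [ b ]  ≡⟨ ++-assoc X (B ++ [ a ]) (B ++ [ b ]) ⟨
    (X ++ B ++ [ a ]) ++ B ++ [ b ]  ≡⟨ ++-assoc (X ++ B ++ [ a ]) B [ b ] ⟨
    ((X ++ B ++ [ a ]) ++ B) ++ [ b ] ∎

runLength-rep : ∀ x j {w} → runLength x w ≡ 0 → runLength x (rep j x ++ w) ≡ j
runLength-rep a zero r = r
runLength-rep a (suc j) r = cong suc (runLength-rep a j r)
runLength-rep b zero r = r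
runLength-rep b (suc j) r = cong suc (runLength-rep b j r)

deriv-rep : ∀ x j → Deriv (christoffel (x ∷ rep j x)) [ x ]
deriv-rep a j = deriv-a (rep j a) [ a ] (begin
  φ (index (a ∷ rep j a)) [ a ]         ≡⟨ cong (λ k → φ (suc k) [ a ]) index-rep ⟩
  (a ∷ rep (suc j) a ++ [ b ]) ++ []    ≡⟨ ++-identityʳ _ ⟩
  a ∷ rep (suc j) a ++ [ b ]            ≡⟨ cong (λ t → a ∷ t ++ [ b ]) (ψ-rep (suc j) a) ⟨
  christoffel (a ∷ rep j a)             ∎)
  where
  index-rep : runLength a (rep j a) ≡ j
  index-rep = trans (cong (runLength a) (sym (++-identityʳ (rep j a)))) (runLength-rep a j refl)
deriv-rep b j = deriv-b (rep j b) [ b ] (begin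
  φ̂ (index (b ∷ rep j b)) [ b ]         ≡⟨ cong (λ k → φ̂ (suc k) [ b ]) index-rep ⟩
  (a ∷ b ∷ rep (suc j) b) ++ []         ≡⟨ ++-identityʳ _ ⟩
  a ∷ b ∷ rep (suc j) b                 ≡⟨ cong (a ∷_) (rep-snoc (suc j) b) ⟨
  a ∷ rep (suc j) b ++ [ b ]            ≡⟨ cong (λ t → a ∷ t ++ [ b ]) (ψ-rep (suc j) b) ⟨
  christoffel (b ∷ rep j b)             ∎)
  where
  index-rep : runLength b (rep j b) ≡ j
  index-rep = trans (cong (runLength b) (sym (++-identityʳ (rep j b)))) (runLength-rep b j refl)

deriv-rep-other : ∀ x j u → Deriv (christoffel (x ∷ rep j x ++ other x ∷ u)) (christoffel u)
deriv-rep-other a j u = deriv-a (rep j a ++ b ∷ u) (christoffel u)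
  (trans (cong (λ k → φ (suc k) (christoffel u)) (runLength-rep a j refl)) (φ-christoffel (suc j) u))
deriv-rep-other b j u = deriv-b (rep j b ++ a ∷ u) (christoffel u)
  (trans (cong (λ k → φ̂ (suc k) (christoffel u)) (runLength-rep b j refl)) (φ̂-christoffel (suc j) u))

φ-tail : Letter → Word
φ-tail a = [ b ]
φ-tail b = []

φ-cons : ∀ k c w → φ k (c ∷ w) ≡ rep k a ++ c ∷ φ-tail c ++ φ k w
φ-cons k a w = begin
  ((a ∷ rep k a) ++ [ b ]) ++ φ k w     ≡⟨ cong (λ t → (t ++ [ b ]) ++ φ k w) (rep-snoc k a) ⟨
  ((rep k a ++ [ a ]) ++ [ b ]) ++ φ k w ≡⟨ ++-assoc (rep k a ++ [ a ]) [ b ] (φ k w) ⟩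
  (rep k a ++ [ a ]) ++ b ∷ φ k w       ≡⟨ ++-assoc (rep k a) [ a ] (b ∷ φ k w) ⟩
  rep k a ++ a ∷ b ∷ φ k w              ∎
φ-cons k b w = ++-assoc (rep k a) [ b ] (φ k w)

φ-injective : ∀ k {w₁ w₂} → φ k w₁ ≡ φ k w₂ → w₁ ≡ w₂
φ-injective k {[]} {[]} _ = refl
φ-injective k {[]} {c ∷ w} e = ⊥-elim (++-∷-≢-[] (rep k a) (sym (trans e (φ-cons k c w))))
φ-injective k {c ∷ w} {[]} e = ⊥-elim (++-∷-≢-[] (rep k a) (trans (sym (φ-cons k c w)) e))
φ-injective k {c ∷ w₁} {d ∷ w₂} e
  with e′ ← ++-cancelˡ (rep k a) _ _ (trans (sym (φ-cons k c w₁)) (trans e (φ-cons k d w₂)))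
  with refl ← ∷-injectiveˡ e′ = cong (c ∷_) (φ-injective k (++-cancelˡ (φ-tail c) _ _ (∷-injectiveʳ e′)))

φ̂-tail : Letter → Word
φ̂-tail a = []
φ̂-tail b = [ b ]

φ̂-cons : ∀ k c w → φ̂ k (c ∷ w) ≡ a ∷ rep k b ++ φ̂-tail c ++ φ̂ k w
φ̂-cons k a w = refl
φ̂-cons k b w = cong (a ∷_) (trans (cong (_++ φ̂ k w) (sym (rep-snoc k b))) (++-assoc (rep k b) [ b ] (φ̂ k w)))

φ̂-head : ∀ k w {t} → φ̂ k w ≡ b ∷ t → ⊥
φ̂-head k [] ()
φ̂-head k (a ∷ w) ()
φ̂-head k (b ∷ w) ()

φ̂-tail-cancel : ∀ k c d {w₁ w₂} → φ̂-tail c ++ φ̂ k w₁ ≡ φ̂-tail d ++ φ̂ k w₂ → c ≡ d × φ̂ k w₁ ≡ φ̂ k w₂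
φ̂-tail-cancel k a a e = refl , e
φ̂-tail-cancel k b b e = refl , ∷-injectiveʳ e
φ̂-tail-cancel k a b {w₁} e = ⊥-elim (φ̂-head k w₁ e)
φ̂-tail-cancel k b a {w₂ = w₂} e = ⊥-elim (φ̂-head k w₂ (sym e))

φ̂-injective : ∀ k {w₁ w₂} → φ̂ k w₁ ≡ φ̂ k w₂ → w₁ ≡ w₂
φ̂-injective k {[]} {[]} _ = refl
φ̂-injective k {[]} {a ∷ _} ()
φ̂-injective k {[]} {b ∷ _} ()
φ̂-injective k {a ∷ _} {[]} ()
φ̂-injective k {b ∷ _} {[]} ()
φ̂-injective k {c ∷ w₁} {d ∷ w₂} e
  with refl , e′ ← φ̂-tail-cancel k c d {w₁} {w₂} (++-cancelˡ (rep k b) _ _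
         (∷-injectiveʳ (trans (sym (φ̂-cons k c w₁)) (trans e (φ̂-cons k d w₂)))))
  = cong (c ∷_) (φ̂-injective k e′)

ψ-cons-ν : ∀ x v → ψ (x ∷ v) ≡ x ∷ ν x (ψ v)
ψ-cons-ν x v = trans (ψ-cons x v) (μ-snoc x (ψ v))

ψ-injective : ∀ {v v′} → ψ v ≡ ψ v′ → v ≡ v′
ψ-injective {[]} {[]} _ = refl
ψ-injective {[]} {y ∷ v′} e with trans e (ψ-cons-ν y v′)
... | ()
ψ-injective {x ∷ v} {[]} e with trans (sym e) (ψ-cons-ν x v)
... | ()
ψ-injective {x ∷ v} {y ∷ v′} e
  with e′ ← trans (sym (ψ-cons-ν x v)) (trans e (ψ-cons-ν y v′))
  with refl ← ∷-injectiveˡ e′ = cong (x ∷_) (ψ-injective (ν-injective x (∷-injectiveʳ e′)))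

christoffel-injective : ∀ {v v′} → christoffel v ≡ christoffel v′ → v ≡ v′
christoffel-injective {v} {v′} e = ψ-injective (∷ʳ-injectiveˡ (ψ v) (ψ v′) (∷-injectiveʳ e))

deriv-functional : ∀ {w₁ w₂ w₁′ w₂′} → Deriv w₁ w₁′ → Deriv w₂ w₂′ → w₁ ≡ w₂ → w₁′ ≡ w₂′
deriv-functional deriv-ab deriv-ab _ = refl
deriv-functional (deriv-a u _ e₁) (deriv-a u′ _ e₂) e
  with refl ← christoffel-injective {a ∷ u} {a ∷ u′} e = φ-injective _ (trans e₁ (sym e₂))
deriv-functional (deriv-b u _ e₁) (deriv-b u′ _ e₂) e
  with refl ← christoffel-injective {b ∷ u} {b ∷ u′} e = φ̂-injective _ (trans e₁ (sym e₂))
deriv-functional deriv-ab (deriv-a u _ _) e with christoffel-injective {[]} {a ∷ u} e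
... | ()
deriv-functional deriv-ab (deriv-b u _ _) e with christoffel-injective {[]} {b ∷ u} e
... | ()
deriv-functional (deriv-a u _ _) deriv-ab e with christoffel-injective {a ∷ u} {[]} e
... | ()
deriv-functional (deriv-b u _ _) deriv-ab e with christoffel-injective {b ∷ u} {[]} e
... | ()
deriv-functional (deriv-a u _ _) (deriv-b u′ _ _) e with christoffel-injective {a ∷ u} {b ∷ u′} e
... | ()
deriv-functional (deriv-b u _ _) (deriv-a u′ _ _) e with christoffel-injective {b ∷ u} {a ∷ u′} e
... | ()

-- Depth and height

christoffel-not-letter : ∀ v → SingleLetter (christoffel v) → ⊥
christoffel-not-letter v (_ , e) = ++-∷-≢-[] (ψ v) (∷-injectiveʳ e)

depth-letter : ∀ x → Depth [ x ] zero
depth-letter x = ([ x ] , iter-zero [ x ] , x , refl) , λ _ ()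

depth-suc : ∀ {w w′ d} → (SingleLetter w → ⊥) → Deriv w w′ → Depth w′ d → Depth w (suc d)
depth-suc {w} {d = d} notLetter ∂w ((w″ , ∂ᵈw′ , letter) , minimal) =
  (w″ , iter-suc ∂w ∂ᵈw′ , letter) , minimal′
  where
  minimal′ : ∀ d′ → d′ < suc d → ∀ w‴ → Iter d′ w w‴ → SingleLetter w‴ → ⊥
  minimal′ zero _ _ (iter-zero _) = notLetter
  minimal′ (suc d′) (s≤s d′<d) w‴ (iter-suc ∂w₁ ∂ᵈ′w₁) with refl ← deriv-functional ∂w₁ ∂w refl =
    minimal d′ d′<d w‴ ∂ᵈ′w₁

height-constant : ∀ {v} → Constant v → Height v 1
height-constant c = 0 , refl , c , λ _ ()

iterate-plus-suc : ∀ m v → iterate (suc m) plus v ≡ iterate m plus (plus v)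
iterate-plus-suc zero v = refl
iterate-plus-suc (suc m) v = cong plus (iterate-plus-suc m v)

height-suc : ∀ {v h} → (Constant v → ⊥) → Height (plus v) h → Height v (suc h)
height-suc {v} nonConstant (n , refl , constant , minimal) =
  suc n , refl , subst Constant (sym (iterate-plus-suc n v)) constant , minimal′
  where
  minimal′ : ∀ m → m < suc n → Constant (iterate m plus v) → ⊥
  minimal′ zero _ = nonConstant
  minimal′ (suc m) (s≤s m<n) c = minimal m m<n (subst Constant (iterate-plus-suc m v) c)

data Run (x : Letter) : Word → Set where
  rep-only  : ∀ j → Run x (rep j x)
  rep-other : ∀ j u → Run x (rep j x ++ other x ∷ u)

run : ∀ x u → Run x u
run x [] = rep-only 0
run x (c ∷ u) with letter-dichotomy x c
... | inj₂ refl = rep-other 0 u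
... | inj₁ refl with run x u
...   | rep-only j = rep-only (suc j)
...   | rep-other j u′ = rep-other (suc j) u′

all-rep : ∀ x j → All (_≡ x) (rep j x)
all-rep x zero = []
all-rep x (suc j) = refl ∷ all-rep x j

constant-rep : ∀ x j → Constant (rep j x)
constant-rep a j = inj₁ (all-rep a j)
constant-rep b j = inj₂ (all-rep b j)

all-≡-rep-other : ∀ {x c} j u → All (_≡ c) (x ∷ rep j x ++ other x ∷ u) → other x ≡ x
all-≡-rep-other j u (x≡c ∷ rest) with y≡c ∷ _ ← ++⁻ʳ (rep j _) rest = trans y≡c (sym x≡c)

nonConstant-rep-other : ∀ x j u → Constant (x ∷ rep j x ++ other x ∷ u) → ⊥
nonConstant-rep-other x j u (inj₁ all) = other-≢ x (all-≡-rep-other j u all)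
nonConstant-rep-other x j u (inj₂ all) = other-≢ x (all-≡-rep-other j u all)

plus-rep-other : ∀ x j u → plus (x ∷ rep j x ++ other x ∷ u) ≡ u
plus-rep-other a zero u = refl
plus-rep-other a (suc j) u = plus-rep-other a j u
plus-rep-other b zero u = refl
plus-rep-other b (suc j) u = plus-rep-other b j u

_⊏_ : Word → Word → Set
u ⊏ v = length u < length v

⊏-wellFounded : WellFounded _⊏_
⊏-wellFounded = on-wellFounded length <-wellFounded

⊏-rep-other : ∀ x j u → u ⊏ (x ∷ rep j x ++ other x ∷ u)
⊏-rep-other x j u = s≤s (≤-trans (n≤1+n (length u)) (length-++-≤ʳ (other x ∷ u) {rep j x}))

height-depth : ∀ v → Acc _⊏_ v → Σ ℕ λ h → Height v h × Depth (christoffel v) h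
height-depth [] _ =
  1 , height-constant (inj₁ []) , depth-suc (christoffel-not-letter []) deriv-ab (depth-letter a)
height-depth (x ∷ u) (acc shorter) with run x u
... | rep-only j =
  1 , height-constant (constant-rep x (suc j)) , depth-suc (christoffel-not-letter (x ∷ rep j x)) (deriv-rep x j) (depth-letter x)
... | rep-other j u′ with h , height , depth ← height-depth u′ (shorter (⊏-rep-other x j u′)) =
  suc h ,
  height-suc (nonConstant-rep-other x j u′) (subst (λ t → Height t h) (sym (plus-rep-other x j u′)) height) ,
  depth-suc (christoffel-not-letter (x ∷ rep j x ++ other x ∷ u′)) (deriv-rep-other x j u′) depth

mainTheorem9 : (v : Word) →
    Σ ℕ (λ h → Height v h × Depth (christoffel v) h)
mainTheorem9 v = height-depth v (⊏-wellFounded v)
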